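{- Let $K$ be an algebraically closed field of characteristic $0$ and let $x_0,x_1$ be the initial cluster of the coefficient-free cluster algebra $\mathcal{A}(2,2)$ (over $K$). For $n\ge 1$ and a point $\boldsymbol{a}^{(n)}=(a_1,\dots,a_n)\in(K^\times)^n$, set \[ S_{\boldsymbol{a}^{(n)},r}=\sum_{\substack{I,J\subseteq[1,n]\\ |I|=r=|J|\\ I\cap J=\varnothing}}\frac{\prod_{i\in I}a_i}{\prod_{j\in J}a_j} \] and \[ x_{(n,-n)}^{\boldsymbol{a}^{(n)}}:=x_0^{ -n}x_1^{ -n}\sum_{0\le k\le \ell\le n}\sum_{r=0}^{\ell}\binom{\ell-r}{k}\binom{n-2r}{\ell-r}S_{\boldsymbol{a}^{(n)},r}\,x_0^{2(\ell-k)}x_1^{2(n-\ell)}. \] For $m\ge 0$ let $x_{(m,-m)}^{ge}:=\big(x_0x_1^{ -1}+x_0^{ -1}x_1^{ -1}+x_0^{ -1}x_1\big)^m=x_0^{ -m}x_1^{ -m}\sum_{0\le k\le \ell\le m}\binom{\ell}{k}\binom{m}{\ell}x_0^{2(\ell-k)}x_1^{2(m-\ell)}$ (the generic basis elements with $\boldsymbol{g}$-vector $(m,-m)$). Then for $n\ge 0$, \[ x_{(n,-n)}^{\boldsymbol{a}^{(n)}}=\sum_{r=0}^{\lfloor n/2\rfloor}S_{\boldsymbol{a}^{(n)},r}\,x_{(n-2r,-n+2r)}^{ge}. \]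
   Context: $\mathcal{A}(2,2)$ is the cluster algebra generated by cluster variables $x_m$, $m\in\mathbb{Z}$, with $x_{m-1}x_{m+1}=x_m^2+1$. The elements $x_{(n,-n)}^{\boldsymbol{a}^{(n)}}$ come from generalized minors (Rupel–Stella–Williams). -}

module Defs where

open import Level using (Level; _⊔_) renaming (suc to lsuc)
open import Algebra.Bundles using (CommutativeRing)
open import Data.Nat as ℕ using (ℕ; zero; suc; _∸_; _≡ᵇ_)
open import Data.Nat.Combinatorics using (_C_)
open import Data.Integer as ℤ using (ℤ; +_)
import Data.Bool
open import Data.Bool using (Bool; true; false; _∧_; not; if_then_else_)
open import Data.Product using (_×_; _,_; ∃)
open import Data.List as List using (List; []; _∷_; _++_; map; concatMap; filter; foldr; upTo)
open import Data.Vec using (Vec; []; _∷_)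
open import Data.Fin.Subset using (Subset; ∣_∣)
open import Relation.Nullary using (¬_)
open import Relation.Nullary.Decidable using (⌊_⌋; _×-dec_)
open import Relation.Binary.PropositionalEquality using (_≡_)

record Field (c ℓ : Level) : Set (lsuc (c ⊔ ℓ)) where
  field
    commutativeRing : CommutativeRing c ℓ
  open CommutativeRing commutativeRing
  field
    0≉1     : ¬ (0# ≈ 1#)
    inverse : ∀ x → ¬ (x ≈ 0#) → ∃ λ y → x * y ≈ 1#

module RingOps {c ℓ} (R : CommutativeRing c ℓ) where
  open CommutativeRing R

  fromℕ : ℕ → Carrier
  fromℕ zero    = 0#
  fromℕ (suc n) = 1# + fromℕ n

  _^_ : Carrier → ℕ → Carrier
  x ^ zero  = 1#
  x ^ suc n = x * (x ^ n)

  evalMonic : ∀ {d} → Vec Carrier d → Carrier → Carrier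
  evalMonic {d} cs x = x ^ d + go cs 0
    where
    go : ∀ {m} → Vec Carrier m → ℕ → Carrier
    go []       i = 0#
    go (a ∷ as) i = a * (x ^ i) + go as (suc i)

  record Unit : Set (c ⊔ ℓ) where
    field
      val  : Carrier
      inv  : Carrier
      val*inv≈1 : val * inv ≈ 1#



IsAlgClosed : ∀ {c ℓ} → Field c ℓ → Set (c ⊔ ℓ)
IsAlgClosed K = ∀ (d : ℕ) (cs : Vec Carrier (suc d)) → ∃ λ x → evalMonic cs x ≈ 0#
  where
  open Field K
  open CommutativeRing commutativeRing
  open RingOps commutativeRing

CharZero : ∀ {c ℓ} → Field c ℓ → Set ℓ
CharZero K = ∀ (n : ℕ) → ¬ (fromℕ (suc n) ≈ 0#)
  where
  open Field K
  open CommutativeRing commutativeRing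
  open RingOps commutativeRing

-- Laurent polynomials in x₀, x₁ over R, as finite formal sums of terms
-- c · x₀^i x₁^j (i, j ∈ ℤ).  Two formal sums are equal as Laurent
-- polynomials iff all their coefficients agree.

module Laurent {c ℓ} (R : CommutativeRing c ℓ) where
  open CommutativeRing R
  open RingOps R

  LP : Set c
  LP = List (Carrier × ℤ × ℤ)

  mono : Carrier → ℤ → ℤ → LP
  mono a i j = (a , i , j) ∷ []

  coeff : LP → ℤ → ℤ → Carrier
  coeff []                 i j = 0#
  coeff ((a , i' , j') ∷ p) i j =
    (if ⌊ i' ℤ.≟ i ⌋ ∧ ⌊ j' ℤ.≟ j ⌋ then a else 0#) + coeff p i j

  _≋_ : LP → LP → Set ℓ
  p ≋ q = ∀ (i j : ℤ) → coeff p i j ≈ coeff q i j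

  infixr 6 _⊕_
  infixr 7 _⊗_ _·_
  infix 4 _≋_
  _⊕_ : LP → LP → LP
  p ⊕ q = p ++ q

  ⨁ : List LP → LP
  ⨁ = foldr _⊕_ []

  _⊗_ : LP → LP → LP
  p ⊗ q = concatMap (λ { (a , i , j) → map (λ { (b , k , l) → (a * b , i ℤ.+ k , j ℤ.+ l) }) q }) p

  _·_ : Carrier → LP → LP
  a · p = mono a (+ 0) (+ 0) ⊗ p

  _^ᴸ_ : LP → ℕ → LP
  p ^ᴸ zero  = mono 1# (+ 0) (+ 0)
  p ^ᴸ suc m = p ⊗ (p ^ᴸ m)

  ΣK : List Carrier → Carrier
  ΣK = foldr _+_ 0#

  subsets : (n : ℕ) → List (Subset n)
  subsets zero    = [] ∷ []
  subsets (suc n) = map (true ∷_) (subsets n) ++ map (false ∷_) (subsets n)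

  disjointᵇ : ∀ {n} → Subset n → Subset n → Bool
  disjointᵇ []       []       = true
  disjointᵇ (x ∷ xs) (y ∷ ys) = not (x ∧ y) ∧ disjointᵇ xs ys

  prodVal : ∀ {n} → Subset n → Vec Unit n → Carrier
  prodVal []           []       = 1#
  prodVal (true  ∷ I) (a ∷ as) = Unit.val a * prodVal I as
  prodVal (false ∷ I) (a ∷ as) = prodVal I as

  prodInv : ∀ {n} → Subset n → Vec Unit n → Carrier
  prodInv []           []       = 1#
  prodInv (true  ∷ J) (a ∷ as) = Unit.inv a * prodInv J as
  prodInv (false ∷ J) (a ∷ as) = prodInv J as

  S : ∀ {n} → Vec Unit n → ℕ → Carrier
  S {n} a r = ΣK (map (λ { (I , J) → prodVal I a * prodInv J a })
    (List.filter (λ { (I , J) → ((∣ I ∣ ℕ.≟ r) ×-dec (∣ J ∣ ℕ.≟ r)) ×-dec (disjointᵇ I J Data.Bool.≟ true) })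
      (List.cartesianProduct (subsets n) (subsets n))))

  xA : (n : ℕ) → Vec Unit n → LP
  xA n a = mono 1# (ℤ.- (+ n)) (ℤ.- (+ n)) ⊗
    ⨁ (concatMap (λ l → concatMap (λ k → map (λ r →
          mono (fromℕ (((l ∸ r) C k) ℕ.* ((n ∸ (2 ℕ.* r)) C (l ∸ r))) * S a r)
               (+ (2 ℕ.* (l ∸ k))) (+ (2 ℕ.* (n ∸ l))))
        (upTo (suc l))) (upTo (suc l))) (upTo (suc n)))

  xge : ℕ → LP
  xge m = (mono 1# (+ 1) (ℤ.- (+ 1)) ⊕ mono 1# (ℤ.- (+ 1)) (ℤ.- (+ 1)) ⊕ mono 1# (ℤ.- (+ 1)) (+ 1)) ^ᴸ m

-- Since x₀x₁⁻¹ + x₀⁻¹x₁⁻¹ + x₀⁻¹x₁ = x₀⁻¹x₁⁻¹(1 + x₀² + x₁²), two applications of the binomial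
-- theorem give the closed form of x^ge_m.  In the sum defining x^a_(n,−n), exchange the sums over ℓ
-- and r and substitute ℓ = r + l: S_{a,r} vanishes for 2r > n (there are no two disjoint r-subsets
-- of [1,n]), and for 2r ≤ n the remaining sum over l, k is S_{a,r} x₀^{2r} x₁^{2r} times the
-- numerator of the closed form of x^ge_{n−2r}.  Formal sums compared coefficientwise form a
-- commutative semiring, which is where the binomial theorem is applied.  The identity holds over
-- any commutative ring.

module Submission where

open import Defs
open import Level using (Level)
open import Algebra.Bundles using (CommutativeRing; CommutativeSemiring; Semiring)
open import Data.Bool using (Bool; true; false; _∧_; if_then_else_)
open import Data.Fin using (toℕ)
open import Data.Fin.Properties using (toℕ<n)
open import Data.Fin.Subset using (Subset; ∣_∣)
open import Data.Integer as ℤ using (ℤ)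
import Data.Integer.Properties as ℤ
open import Data.Integer.Solver using (module +-*-Solver)
open import Data.List using (List; []; _∷_; _++_; map; concatMap; filter; cartesianProduct; upTo; applyUpTo)
import Data.List.Properties as List
import Data.List.Relation.Unary.All as All
open import Data.Nat as ℕ using (ℕ; zero; suc; _∸_; _≤_; _<_; s≤s)
import Data.Nat.Properties as ℕ
open import Data.Nat.Combinatorics using (_C_; k>n⇒nCk≡0)
open import Data.Nat.DivMod using (_/_; m/n≤m; m/n*n≤m; /-monoˡ-≤; m*n/n≡m)
open import Data.Nat.Tactic.RingSolver using (solve-∀)
open import Data.Product using (_×_; _,_; proj₁; proj₂)
open import Data.Vec using (Vec; []; _∷_)
open import Function using (_∘_; mk⇔)
open import Relation.Nullary using (¬_)
open import Relation.Nullary.Decidable using (⌊_⌋; does-⇔; isYes≗does)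
open import Relation.Unary using (Decidable)
open import Relation.Binary.PropositionalEquality as ≡ using (_≡_)

private variable
  a : Level
  A B : Set a

r≤n/2⇒2r≤n : ∀ {n r} → r ≤ n / 2 → 2 ℕ.* r ≤ n
r≤n/2⇒2r≤n {n} {r} r≤n/2 =
  ℕ.≤-trans (ℕ.*-monoʳ-≤ 2 r≤n/2) (ℕ.≤-trans (ℕ.≤-reflexive (ℕ.*-comm 2 (n / 2))) (m/n*n≤m n 2))

n/2<r⇒n<2r : ∀ {n r} → n / 2 < r → n < 2 ℕ.* r
n/2<r⇒n<2r {n} {r} n/2<r = ℕ.≰⇒> λ 2r≤n → ℕ.<⇒≱ n/2<r (begin
  r             ≡⟨ m*n/n≡m r 2 ⟨
  r ℕ.* 2 / 2   ≤⟨ /-monoˡ-≤ 2 (ℕ.≤-trans (ℕ.≤-reflexive (ℕ.*-comm r 2)) 2r≤n) ⟩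
  n / 2         ∎)
  where open ℕ.≤-Reasoning

∸-+-split : ∀ n r {l} → 2 ℕ.* r ≤ n → l ≤ n ∸ 2 ℕ.* r → n ∸ (r ℕ.+ l) ≡ r ℕ.+ (n ∸ 2 ℕ.* r ∸ l)
∸-+-split n r {l} 2r≤n l≤m = ≡.trans (≡.cong (_∸ (r ℕ.+ l)) n≡) (ℕ.m+n∸m≡n (r ℕ.+ l) (r ℕ.+ d))
  where
  d = n ∸ 2 ℕ.* r ∸ l
  n≡ : n ≡ (r ℕ.+ l) ℕ.+ (r ℕ.+ d)
  n≡ = ≡.trans (≡.sym (ℕ.m+[n∸m]≡n 2r≤n)) (≡.trans (≡.cong (2 ℕ.* r ℕ.+_) (≡.sym (ℕ.m+[n∸m]≡n l≤m)))
         (rearrange r l d))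
    where
    rearrange : ∀ r l d → 2 ℕ.* r ℕ.+ (l ℕ.+ d) ≡ (r ℕ.+ l) ℕ.+ (r ℕ.+ d)
    rearrange = solve-∀

module RangeSums {c ℓ} (SR : Semiring c ℓ) where
  open Semiring SR
  open import Algebra.Properties.Semiring.Sum SR
    using (sum; sum-cong-≋; sum-replicate-zero; ∑-comm; ∑-distrib-+; *-distribˡ-sum; *-distribʳ-sum)
  open import Relation.Binary.Reasoning.Setoid setoid

  ∑< : ℕ → (ℕ → Carrier) → Carrier
  ∑< n f = sum {n} (λ i → f (toℕ i))

  ∑<-cong : ∀ n {f g : ℕ → Carrier} → (∀ i → i < n → f i ≈ g i) → ∑< n f ≈ ∑< n g
  ∑<-cong n f≈g = sum-cong-≋ {n} (λ i → f≈g (toℕ i) (toℕ<n i))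

  ∑<-zero : ∀ n {f : ℕ → Carrier} → (∀ i → f i ≈ 0#) → ∑< n f ≈ 0#
  ∑<-zero n f≈0 = trans (sum-cong-≋ {n} (λ i → f≈0 (toℕ i))) (sum-replicate-zero n)

  ∑<-comm : ∀ m n (f : ℕ → ℕ → Carrier) → ∑< m (λ i → ∑< n (f i)) ≈ ∑< n (λ j → ∑< m (λ i → f i j))
  ∑<-comm m n f = ∑-comm {m} {n} (λ i j → f (toℕ i) (toℕ j))

  *-distribˡ-∑< : ∀ x n (f : ℕ → Carrier) → x * ∑< n f ≈ ∑< n (λ i → x * f i)
  *-distribˡ-∑< x n f = *-distribˡ-sum {n} x (λ i → f (toℕ i))

  *-distribʳ-∑< : ∀ x n (f : ℕ → Carrier) → ∑< n f * x ≈ ∑< n (λ i → f i * x)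
  *-distribʳ-∑< x n f = *-distribʳ-sum {n} x (λ i → f (toℕ i))

  ∑<-+ : ∀ m n (f : ℕ → Carrier) → ∑< (m ℕ.+ n) f ≈ ∑< m f + ∑< n (λ i → f (m ℕ.+ i))
  ∑<-+ zero    n f = sym (+-identityˡ _)
  ∑<-+ (suc m) n f = trans (+-congˡ (∑<-+ m n (f ∘ suc))) (sym (+-assoc _ _ _))

  ∑<-truncate : ∀ {m n} (f : ℕ → Carrier) → m ≤ n → (∀ i → m ≤ i → f i ≈ 0#) → ∑< n f ≈ ∑< m f
  ∑<-truncate {m} {n} f m≤n f≈0 = begin
    ∑< n f                                    ≡⟨ ≡.cong (λ k → ∑< k f) (ℕ.m+[n∸m]≡n m≤n) ⟨
    ∑< (m ℕ.+ (n ∸ m)) f                      ≈⟨ ∑<-+ m (n ∸ m) f ⟩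
    ∑< m f + ∑< (n ∸ m) (λ i → f (m ℕ.+ i))
      ≈⟨ +-congˡ (∑<-zero (n ∸ m) (λ i → f≈0 (m ℕ.+ i) (ℕ.m≤m+n m i))) ⟩
    ∑< m f + 0#                               ≈⟨ +-identityʳ _ ⟩
    ∑< m f                                    ∎

  ∑<-triangle : ∀ n (f : ℕ → ℕ → Carrier) →
                ∑< n (λ l → ∑< (suc l) (f l)) ≈ ∑< n (λ r → ∑< (n ∸ r) (λ l → f (r ℕ.+ l) r))
  ∑<-triangle zero    f = refl
  ∑<-triangle (suc n) f = begin
    (f 0 0 + 0#) + ∑< n (λ l → f (suc l) 0 + ∑< (suc l) (g l))
      ≈⟨ +-cong (+-identityʳ _) (∑-distrib-+ {n} (λ i → f (suc (toℕ i)) 0) (λ i → ∑< (suc (toℕ i)) (g (toℕ i)))) ⟩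
    f 0 0 + (∑< n (λ l → f (suc l) 0) + ∑< n (λ l → ∑< (suc l) (g l)))
      ≈⟨ +-congˡ (+-congˡ (∑<-triangle n g)) ⟩
    f 0 0 + (∑< n (λ l → f (suc l) 0) + ∑< n (λ r → ∑< (n ∸ r) (λ l → g (r ℕ.+ l) r)))
      ≈⟨ +-assoc _ _ _ ⟨
    ∑< (suc n) (λ l → f l 0) + ∑< n (λ r → ∑< (n ∸ r) (λ l → f (suc r ℕ.+ l) (suc r)))  ∎
    where
    g : ℕ → ℕ → Carrier
    g l r = f (suc l) (suc r)

module LaurentSemiring {c ℓ} (R : CommutativeRing c ℓ) where
  open CommutativeRing R
  open Laurent R
  open import Relation.Binary.Reasoning.Setoid setoid
  open import Algebra.Properties.CommutativeSemigroup +-commutativeSemigroup using (interchange)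

  sumOver : List A → (A → Carrier) → Carrier
  sumOver []       f = 0#
  sumOver (x ∷ xs) f = f x + sumOver xs f

  sumOver-cong : ∀ (xs : List A) {f g} → (∀ x → f x ≈ g x) → sumOver xs f ≈ sumOver xs g
  sumOver-cong []       f≈g = refl
  sumOver-cong (x ∷ xs) f≈g = +-cong (f≈g x) (sumOver-cong xs f≈g)

  sumOver-++ : ∀ (xs ys : List A) f → sumOver (xs ++ ys) f ≈ sumOver xs f + sumOver ys f
  sumOver-++ []       ys f = sym (+-identityˡ _)
  sumOver-++ (x ∷ xs) ys f = trans (+-congˡ (sumOver-++ xs ys f)) (sym (+-assoc _ _ _))

  sumOver-zero : ∀ (xs : List A) → sumOver xs (λ _ → 0#) ≈ 0#
  sumOver-zero []       = refl
  sumOver-zero (x ∷ xs) = trans (+-identityˡ _) (sumOver-zero xs)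

  sumOver-distrib-+ : ∀ (xs : List A) f g → sumOver xs (λ x → f x + g x) ≈ sumOver xs f + sumOver xs g
  sumOver-distrib-+ []       f g = sym (+-identityˡ 0#)
  sumOver-distrib-+ (x ∷ xs) f g = trans (+-congˡ (sumOver-distrib-+ xs f g)) (interchange _ _ _ _)

  *-distribˡ-sumOver : ∀ k (xs : List A) f → k * sumOver xs f ≈ sumOver xs (λ x → k * f x)
  *-distribˡ-sumOver k []       f = zeroʳ k
  *-distribˡ-sumOver k (x ∷ xs) f = trans (distribˡ k _ _) (+-congˡ (*-distribˡ-sumOver k xs f))

  sumOver-map : ∀ (h : A → B) xs f → sumOver (map h xs) f ≡ sumOver xs (f ∘ h)
  sumOver-map h []       f = ≡.refl
  sumOver-map h (x ∷ xs) f = ≡.cong (f (h x) +_) (sumOver-map h xs f)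

  sumOver-concatMap : ∀ (g : A → List B) xs f → sumOver (concatMap g xs) f ≈ sumOver xs (λ x → sumOver (g x) f)
  sumOver-concatMap g []       f = refl
  sumOver-concatMap g (x ∷ xs) f = trans (sumOver-++ (g x) (concatMap g xs) f) (+-congˡ (sumOver-concatMap g xs f))

  sumOver-comm : ∀ (xs : List A) (ys : List B) (f : A → B → Carrier) →
                 sumOver xs (λ x → sumOver ys (f x)) ≈ sumOver ys (λ y → sumOver xs (λ x → f x y))
  sumOver-comm []       ys f = sym (sumOver-zero ys)
  sumOver-comm (x ∷ xs) ys f = trans (+-congˡ (sumOver-comm xs ys f)) (sym (sumOver-distrib-+ ys (f x) _))

  Term : Set c
  Term = Carrier × ℤ × ℤ

  termCoeff : Term → ℤ → ℤ → Carrier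
  termCoeff (a , u , v) i j = if ⌊ u ℤ.≟ i ⌋ ∧ ⌊ v ℤ.≟ j ⌋ then a else 0#

  mulTerm : Term → Term → Term
  mulTerm (a , u , v) (b , s , t) = (a * b , u ℤ.+ s , v ℤ.+ t)

  coeff≡sumOver : ∀ p i j → coeff p i j ≡ sumOver p (λ t → termCoeff t i j)
  coeff≡sumOver []      i j = ≡.refl
  coeff≡sumOver (t ∷ p) i j = ≡.cong (termCoeff t i j +_) (coeff≡sumOver p i j)

  coeff-⊕ : ∀ p q i j → coeff (p ⊕ q) i j ≈ coeff p i j + coeff q i j
  coeff-⊕ p q i j rewrite coeff≡sumOver (p ++ q) i j | coeff≡sumOver p i j | coeff≡sumOver q i j =
    sumOver-++ p q _

  coeff-⊗ : ∀ p q i j → coeff (p ⊗ q) i j ≈ sumOver p (λ x → sumOver q (λ y → termCoeff (mulTerm x y) i j))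
  coeff-⊗ p q i j rewrite coeff≡sumOver (p ⊗ q) i j =
    trans (sumOver-concatMap _ p _) (sumOver-cong p (λ x → reflexive (sumOver-map (mulTerm x) q _)))

  ≟-shift : ∀ u s i → ⌊ u ℤ.+ s ℤ.≟ i ⌋ ≡ ⌊ s ℤ.≟ i ℤ.- u ⌋
  ≟-shift u s i = ≡.trans (isYes≗does (u ℤ.+ s ℤ.≟ i))
    (≡.trans (does-⇔ (mk⇔ to from) (u ℤ.+ s ℤ.≟ i) (s ℤ.≟ i ℤ.- u)) (≡.sym (isYes≗does (s ℤ.≟ i ℤ.- u))))
    where
    open +-*-Solver
    to : u ℤ.+ s ≡ i → s ≡ i ℤ.- u
    to ≡.refl = solve 2 (λ u s → s := (u :+ s) :- u) ≡.refl u s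
    from : s ≡ i ℤ.- u → u ℤ.+ s ≡ i
    from ≡.refl = solve 2 (λ u i → u :+ (i :- u) := i) ≡.refl u i

  if-zero-* : ∀ (t : Bool) k x → (if t then k * x else 0#) ≈ k * (if t then x else 0#)
  if-zero-* true  k x = refl
  if-zero-* false k x = sym (zeroʳ k)

  termCoeff-mulTerm : ∀ a u v y i j → termCoeff (mulTerm (a , u , v) y) i j ≈ a * termCoeff y (i ℤ.- u) (j ℤ.- v)
  termCoeff-mulTerm a u v (b , s , t) i j rewrite ≟-shift u s i | ≟-shift v t j =
    if-zero-* (⌊ s ℤ.≟ i ℤ.- u ⌋ ∧ ⌊ t ℤ.≟ j ℤ.- v ⌋) a b

  coeff-⊗-convolution : ∀ p q i j →
    coeff (p ⊗ q) i j ≈ sumOver p (λ { (a , u , v) → a * coeff q (i ℤ.- u) (j ℤ.- v) })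
  coeff-⊗-convolution p q i j = trans (coeff-⊗ p q i j) (sumOver-cong p λ { (a , u , v) → begin
    sumOver q (λ y → termCoeff (mulTerm (a , u , v) y) i j)     ≈⟨ sumOver-cong q (λ y → termCoeff-mulTerm a u v y i j) ⟩
    sumOver q (λ y → a * termCoeff y (i ℤ.- u) (j ℤ.- v))       ≈⟨ *-distribˡ-sumOver a q _ ⟨
    a * sumOver q (λ y → termCoeff y (i ℤ.- u) (j ℤ.- v))       ≡⟨ ≡.cong (a *_) (coeff≡sumOver q _ _) ⟨
    a * coeff q (i ℤ.- u) (j ℤ.- v)                             ∎ })

  -- a record rather than _≋_ itself, so that p and q can be inferred from a proof of p ≈ᴸ q
  record _≈ᴸ_ (p q : LP) : Set ℓ where
    constructor wrap
    field unwrap : p ≋ q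
  open _≈ᴸ_ public
  infix 4 _≈ᴸ_

  ≈ᴸ-refl : ∀ {p} → p ≈ᴸ p
  ≈ᴸ-refl = wrap λ i j → refl

  ≈ᴸ-sym : ∀ {p q} → p ≈ᴸ q → q ≈ᴸ p
  ≈ᴸ-sym (wrap e) = wrap λ i j → sym (e i j)

  ≈ᴸ-trans : ∀ {p q r} → p ≈ᴸ q → q ≈ᴸ r → p ≈ᴸ r
  ≈ᴸ-trans (wrap e) (wrap f) = wrap λ i j → trans (e i j) (f i j)

  ⊕-cong : ∀ {p p′ q q′} → p ≈ᴸ p′ → q ≈ᴸ q′ → p ⊕ q ≈ᴸ p′ ⊕ q′
  ⊕-cong {p} {p′} {q} {q′} (wrap e) (wrap f) =
    wrap λ i j → trans (coeff-⊕ p q i j) (trans (+-cong (e i j) (f i j)) (sym (coeff-⊕ p′ q′ i j)))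

  ⊕-assoc : ∀ p q r → (p ⊕ q) ⊕ r ≈ᴸ p ⊕ (q ⊕ r)
  ⊕-assoc p q r = wrap λ i j → reflexive (≡.cong (λ s → coeff s i j) (List.++-assoc p q r))

  ⊕-comm : ∀ p q → p ⊕ q ≈ᴸ q ⊕ p
  ⊕-comm p q = wrap λ i j → trans (coeff-⊕ p q i j) (trans (+-comm _ _) (sym (coeff-⊕ q p i j)))

  ⊕-identityʳ : ∀ p → p ⊕ [] ≈ᴸ p
  ⊕-identityʳ p = wrap λ i j → trans (coeff-⊕ p [] i j) (+-identityʳ _)

  ⊗-congʳ : ∀ p {q q′} → q ≈ᴸ q′ → p ⊗ q ≈ᴸ p ⊗ q′
  ⊗-congʳ p {q} {q′} (wrap e) = wrap λ i j →
    trans (coeff-⊗-convolution p q i j) (trans (sumOver-cong p (λ _ → *-congˡ (e _ _))) (sym (coeff-⊗-convolution p q′ i j)))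

  ·-congʳ : ∀ a {p q} → p ≈ᴸ q → a · p ≈ᴸ a · q
  ·-congʳ a = ⊗-congʳ (mono a (ℤ.+ 0) (ℤ.+ 0))

  ⊗-comm : ∀ p q → p ⊗ q ≈ᴸ q ⊗ p
  ⊗-comm p q = wrap λ i j → begin
    coeff (p ⊗ q) i j
      ≈⟨ coeff-⊗ p q i j ⟩
    sumOver p (λ x → sumOver q (λ y → termCoeff (mulTerm x y) i j))
      ≈⟨ sumOver-comm p q _ ⟩
    sumOver q (λ y → sumOver p (λ x → termCoeff (mulTerm x y) i j))
      ≈⟨ sumOver-cong q (λ y → sumOver-cong p (λ x → mulTerm-comm x y i j)) ⟩
    sumOver q (λ y → sumOver p (λ x → termCoeff (mulTerm y x) i j))
      ≈⟨ coeff-⊗ q p i j ⟨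
    coeff (q ⊗ p) i j ∎
    where
    mulTerm-comm : ∀ x y i j → termCoeff (mulTerm x y) i j ≈ termCoeff (mulTerm y x) i j
    mulTerm-comm (a , u , v) (b , s , t) i j rewrite ℤ.+-comm u s | ℤ.+-comm v t
      with ⌊ s ℤ.+ u ℤ.≟ i ⌋ ∧ ⌊ t ℤ.+ v ℤ.≟ j ⌋
    ... | true  = *-comm a b
    ... | false = refl

  ⊗-assoc : ∀ p q r → (p ⊗ q) ⊗ r ≈ᴸ p ⊗ (q ⊗ r)
  ⊗-assoc p q r = wrap λ i j → begin
    coeff ((p ⊗ q) ⊗ r) i j                                     ≈⟨ coeff-⊗ (p ⊗ q) r i j ⟩
    sumOver (p ⊗ q) (λ x → sumOver r (λ w → termCoeff (mulTerm x w) i j))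
      ≈⟨ sumOver-concatMap _ p _ ⟩
    sumOver p (λ x → sumOver (map (mulTerm x) q) (λ z → sumOver r (λ w → termCoeff (mulTerm z w) i j)))
      ≈⟨ sumOver-cong p (λ x → reflexive (sumOver-map (mulTerm x) q _)) ⟩
    sumOver p (λ x → sumOver q (λ y → sumOver r (λ w → termCoeff (mulTerm (mulTerm x y) w) i j)))
      ≈⟨ sumOver-cong p (λ x → sumOver-cong q (λ y → sumOver-cong r (λ w → mulTerm-assoc x y w i j))) ⟩
    sumOver p (λ x → sumOver q (λ y → sumOver r (λ w → termCoeff (mulTerm x (mulTerm y w)) i j)))
      ≈⟨ sumOver-cong p (λ x → sumOver-cong q (λ y → reflexive (sumOver-map (mulTerm y) r _))) ⟨
    sumOver p (λ x → sumOver q (λ y → sumOver (map (mulTerm y) r) (λ z → termCoeff (mulTerm x z) i j)))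
      ≈⟨ sumOver-cong p (λ x → sumOver-concatMap _ q _) ⟨
    sumOver p (λ x → sumOver (q ⊗ r) (λ z → termCoeff (mulTerm x z) i j))
      ≈⟨ coeff-⊗ p (q ⊗ r) i j ⟨
    coeff (p ⊗ (q ⊗ r)) i j                                     ∎
    where
    mulTerm-assoc : ∀ x y w i j → termCoeff (mulTerm (mulTerm x y) w) i j ≈ termCoeff (mulTerm x (mulTerm y w)) i j
    mulTerm-assoc (a , u , v) (b , s , t) (d , s′ , t′) i j
      rewrite ℤ.+-assoc u s s′ | ℤ.+-assoc v t t′
      with ⌊ u ℤ.+ (s ℤ.+ s′) ℤ.≟ i ⌋ ∧ ⌊ v ℤ.+ (t ℤ.+ t′) ℤ.≟ j ⌋
    ... | true  = *-assoc a b d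
    ... | false = refl

  one : LP
  one = mono 1# (ℤ.+ 0) (ℤ.+ 0)

  ⊗-identityˡ : ∀ p → one ⊗ p ≈ᴸ p
  ⊗-identityˡ p = wrap λ i j → begin
    coeff (one ⊗ p) i j
      ≈⟨ coeff-⊗-convolution one p i j ⟩
    1# * coeff p (i ℤ.- ℤ.+ 0) (j ℤ.- ℤ.+ 0) + 0#
      ≡⟨ ≡.cong₂ (λ i′ j′ → 1# * coeff p i′ j′ + 0#) (ℤ.+-identityʳ i) (ℤ.+-identityʳ j) ⟩
    1# * coeff p i j + 0#
      ≈⟨ trans (+-identityʳ _) (*-identityˡ _) ⟩
    coeff p i j ∎

  ⊗-distribʳ : ∀ p q r → (q ⊕ r) ⊗ p ≈ᴸ (q ⊗ p) ⊕ (r ⊗ p)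
  ⊗-distribʳ p q r = wrap λ i j → begin
    coeff ((q ⊕ r) ⊗ p) i j                   ≈⟨ coeff-⊗ (q ⊕ r) p i j ⟩
    sumOver (q ++ r) _                        ≈⟨ sumOver-++ q r _ ⟩
    sumOver q _ + sumOver r _                 ≈⟨ +-cong (coeff-⊗ q p i j) (coeff-⊗ r p i j) ⟨
    coeff (q ⊗ p) i j + coeff (r ⊗ p) i j     ≈⟨ coeff-⊕ (q ⊗ p) (r ⊗ p) i j ⟨
    coeff ((q ⊗ p) ⊕ (r ⊗ p)) i j             ∎

  open import Relation.Binary.Structures using (IsEquivalence)
  open import Algebra.Structures _≈ᴸ_ using (IsCommutativeMonoid)
  open import Algebra.Structures.Biased _≈ᴸ_ using (isCommutativeSemiringˡ)

  ≈ᴸ-isEquivalence : IsEquivalence _≈ᴸ_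
  ≈ᴸ-isEquivalence = record { refl = ≈ᴸ-refl ; sym = ≈ᴸ-sym ; trans = ≈ᴸ-trans }

  ⊕-isCommutativeMonoid : IsCommutativeMonoid _⊕_ []
  ⊕-isCommutativeMonoid = record
    { isMonoid = record
      { isSemigroup = record
        { isMagma = record { isEquivalence = ≈ᴸ-isEquivalence ; ∙-cong = ⊕-cong }
        ; assoc = ⊕-assoc }
      ; identity = (λ p → ≈ᴸ-refl) , ⊕-identityʳ }
    ; comm = ⊕-comm }

  ⊗-isCommutativeMonoid : IsCommutativeMonoid _⊗_ one
  ⊗-isCommutativeMonoid = record
    { isMonoid = record
      { isSemigroup = record
        { isMagma = record
          { isEquivalence = ≈ᴸ-isEquivalence
          ; ∙-cong = λ {p} {p′} {q} e f → ≈ᴸ-trans (⊗-congˡ e) (⊗-congʳ p′ f) }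
        ; assoc = ⊗-assoc }
      ; identity = ⊗-identityˡ , λ p → ≈ᴸ-trans (⊗-comm p one) (⊗-identityˡ p) }
    ; comm = ⊗-comm }
    where
    ⊗-congˡ : ∀ {p p′ q} → p ≈ᴸ p′ → p ⊗ q ≈ᴸ p′ ⊗ q
    ⊗-congˡ {p} {p′} {q} e = ≈ᴸ-trans (⊗-comm p q) (≈ᴸ-trans (⊗-congʳ q e) (⊗-comm q p′))

  laurentSemiring : CommutativeSemiring c ℓ
  laurentSemiring = record
    { Carrier = LP ; _≈_ = _≈ᴸ_ ; _+_ = _⊕_ ; _*_ = _⊗_ ; 0# = [] ; 1# = one
    ; isCommutativeSemiring = isCommutativeSemiringˡ record
        { +-isCommutativeMonoid = ⊕-isCommutativeMonoid
        ; *-isCommutativeMonoid = ⊗-isCommutativeMonoid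
        ; distribʳ              = ⊗-distribʳ
        ; zeroˡ                 = λ p → ≈ᴸ-refl } }

module Monomials {c ℓ} (R : CommutativeRing c ℓ) where
  open CommutativeRing R
  open RingOps R using (fromℕ)
  open Laurent R
  open LaurentSemiring R
  module 𝕃 = CommutativeSemiring laurentSemiring
  open import Algebra.Properties.Semiring.Mult 𝕃.semiring using (×-assoc-*; ×-congʳ) renaming (_×_ to _×ᴸ_)
  open import Algebra.Properties.Semiring.Mult semiring using (×1-homo-*) renaming (_×_ to _×ᴿ_)
  open import Algebra.Properties.Semiring.Exp 𝕃.semiring using (_^_)

  mono-cong : ∀ {a b u u′ v v′} → a ≈ b → u ≡ u′ → v ≡ v′ → mono a u v ≈ᴸ mono b u′ v′
  mono-cong {u = u} {v = v} a≈b ≡.refl ≡.refl = wrap λ i j → +-congʳ (if-cong (⌊ u ℤ.≟ i ⌋ ∧ ⌊ v ℤ.≟ j ⌋))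
    where
    if-cong : ∀ t → (if t then _ else 0#) ≈ (if t then _ else 0#)
    if-cong true  = a≈b
    if-cong false = refl

  mono-zero : ∀ {a} u v → a ≈ 0# → mono a u v ≈ᴸ []
  mono-zero {a} u v a≈0 = wrap λ i j → vanish (⌊ u ℤ.≟ i ⌋ ∧ ⌊ v ℤ.≟ j ⌋)
    where
    vanish : ∀ t → (if t then a else 0#) + 0# ≈ 0#
    vanish true  = trans (+-identityʳ a) a≈0
    vanish false = +-identityʳ 0#

  mono-+ : ∀ a b u v → mono a u v ⊕ mono b u v ≈ᴸ mono (a + b) u v
  mono-+ a b u v = wrap λ i j → add (⌊ u ℤ.≟ i ⌋ ∧ ⌊ v ℤ.≟ j ⌋)
    where
    add : ∀ t → (if t then a else 0#) + ((if t then b else 0#) + 0#) ≈ (if t then a + b else 0#) + 0#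
    add true  = trans (+-congˡ (+-identityʳ b)) (sym (+-identityʳ (a + b)))
    add false = +-congˡ (+-identityʳ 0#)

  fromℕ≡×1 : ∀ n → fromℕ n ≡ n ×ᴿ 1#
  fromℕ≡×1 zero    = ≡.refl
  fromℕ≡×1 (suc n) = ≡.cong (1# +_) (fromℕ≡×1 n)

  fromℕ-* : ∀ m n → fromℕ (m ℕ.* n) ≈ fromℕ m * fromℕ n
  fromℕ-* m n rewrite fromℕ≡×1 (m ℕ.* n) | fromℕ≡×1 m | fromℕ≡×1 n = ×1-homo-* m n

  ×-mono : ∀ n a u v → n ×ᴸ mono a u v ≈ᴸ mono (fromℕ n * a) u v
  ×-mono zero    a u v = 𝕃.sym (mono-zero u v (zeroˡ a))
  ×-mono (suc n) a u v = 𝕃.trans (𝕃.+-congˡ (×-mono n a u v)) (𝕃.trans (mono-+ a _ u v)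
    (mono-cong (sym (trans (distribʳ a 1# (fromℕ n)) (+-congʳ (*-identityˡ a)))) ≡.refl ≡.refl))

  ×≈· : ∀ n p → n ×ᴸ p ≈ᴸ fromℕ n · p
  ×≈· n p = 𝕃.trans (×-congʳ n (𝕃.sym (𝕃.*-identityˡ p))) (𝕃.trans (𝕃.sym (×-assoc-* n one p))
    (𝕃.*-congʳ (𝕃.trans (×-mono n 1# _ _) (mono-cong (*-identityʳ _) ≡.refl ≡.refl))))

  mono² : Carrier → ℕ → ℕ → LP
  mono² a α β = mono a (ℤ.+ (2 ℕ.* α)) (ℤ.+ (2 ℕ.* β))

  mono²-⊗ : ∀ a b α β γ δ → mono² a α β ⊗ mono² b γ δ ≈ᴸ mono² (a * b) (α ℕ.+ γ) (β ℕ.+ δ)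
  mono²-⊗ a b α β γ δ = mono-cong refl (double α γ) (double β δ)
    where
    double : ∀ x y → ℤ.+ (2 ℕ.* x) ℤ.+ ℤ.+ (2 ℕ.* y) ≡ ℤ.+ (2 ℕ.* (x ℕ.+ y))
    double x y = ≡.cong ℤ.+_ (≡.sym (ℕ.*-distribˡ-+ 2 x y))

  mono²-^ : ∀ α β k → mono² 1# α β ^ k ≈ᴸ mono² 1# (k ℕ.* α) (k ℕ.* β)
  mono²-^ α β zero    = 𝕃.refl
  mono²-^ α β (suc k) = 𝕃.trans (𝕃.*-congˡ {mono² 1# α β} (mono²-^ α β k))
    (𝕃.trans (mono²-⊗ 1# 1# α β _ _) (mono-cong (*-identityˡ 1#) ≡.refl ≡.refl))

  denom : ℕ → LP
  denom m = mono 1# (ℤ.- ℤ.+ m) (ℤ.- ℤ.+ m)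

  denom-^ : ∀ m → denom 1 ^ m ≈ᴸ denom m
  denom-^ zero    = 𝕃.refl
  denom-^ (suc m) = 𝕃.trans (𝕃.*-congˡ {denom 1} (denom-^ m)) (mono-cong (*-identityˡ 1#) e e)
    where
    e : ℤ.- ℤ.+ 1 ℤ.+ ℤ.- ℤ.+ m ≡ ℤ.- ℤ.+ suc m
    e = ≡.trans (≡.sym (ℤ.neg-distrib-+ (ℤ.+ 1) (ℤ.+ m))) (≡.cong ℤ.-_ (≡.sym (ℤ.pos-+ 1 m)))

  denom-⊗-mono² : ∀ n r → 2 ℕ.* r ≤ n → denom n ⊗ mono² 1# r r ≈ᴸ denom (n ∸ 2 ℕ.* r)
  denom-⊗-mono² n r 2r≤n = mono-cong (*-identityˡ 1#) e e
    where
    e : ℤ.- ℤ.+ n ℤ.+ ℤ.+ (2 ℕ.* r) ≡ ℤ.- ℤ.+ (n ∸ 2 ℕ.* r)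
    e = ≡.trans (ℤ.-m+n≡n⊖m n (2 ℕ.* r)) (ℤ.⊖-≤ 2r≤n)

module GenericBasis {c ℓ} (R : CommutativeRing c ℓ) where
  open CommutativeRing R
  open RingOps R using (fromℕ)
  open Laurent R
  open LaurentSemiring R
  open Monomials R
  open RangeSums 𝕃.semiring
  open import Algebra.Properties.Semiring.Mult 𝕃.semiring using (×-congʳ) renaming (_×_ to _×ᴸ_)
  open import Algebra.Properties.Semiring.Exp 𝕃.semiring using (_^_; ^-congˡ)
  open import Algebra.Properties.CommutativeSemiring.Exp laurentSemiring using (^-distrib-*)
  import Algebra.Properties.CommutativeSemiring.Binomial laurentSemiring as Binomial
  open import Algebra.Properties.CommutativeSemigroup 𝕃.+-commutativeSemigroup using (x∙yz≈y∙xz)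
  open import Relation.Binary.Reasoning.Setoid 𝕃.setoid

  geTerm : ℕ → ℕ → ℕ → LP
  geTerm m l k = mono² (fromℕ ((l C k) ℕ.* (m C l))) (l ∸ k) (m ∸ l)

  geSum : ℕ → LP
  geSum m = ∑< (suc m) (λ l → ∑< (suc l) (geTerm m l))

  geBase : LP
  geBase = mono 1# (ℤ.+ 1) (ℤ.- (ℤ.+ 1)) ⊕ mono 1# (ℤ.- (ℤ.+ 1)) (ℤ.- (ℤ.+ 1)) ⊕ mono 1# (ℤ.- (ℤ.+ 1)) (ℤ.+ 1)

  ^ᴸ≡^ : ∀ p m → p ^ᴸ m ≡ p ^ m
  ^ᴸ≡^ p zero    = ≡.refl
  ^ᴸ≡^ p (suc m) = ≡.cong (p ⊗_) (^ᴸ≡^ p m)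

  x₀² x₁² trinomial : LP
  x₀² = mono² 1# 1 0
  x₁² = mono² 1# 0 1
  trinomial = (one ⊕ x₀²) ⊕ x₁²

  geBase≈denom⊗trinomial : geBase ≈ᴸ denom 1 ⊗ trinomial
  geBase≈denom⊗trinomial = 𝕃.trans (x∙yz≈y∙xz (mono 1# _ _) (mono 1# _ _) (mono 1# _ _))
    (⊕-cong one≈ (⊕-cong one≈ (⊕-cong one≈ 𝕃.refl)))
    where
    one≈ : ∀ {u v} → mono 1# u v ≈ᴸ mono (1# * 1#) u v
    one≈ = mono-cong (sym (*-identityˡ 1#)) ≡.refl ≡.refl

  trinomial-term : ∀ c d k α β →
    fromℕ c · ((d ×ᴸ (one ^ k ⊗ x₀² ^ α)) ⊗ x₁² ^ β) ≈ᴸ mono² (fromℕ (d ℕ.* c)) α β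
  trinomial-term c d k α β = begin
    fromℕ c · ((d ×ᴸ (one ^ k ⊗ x₀² ^ α)) ⊗ x₁² ^ β)
      ≈⟨ ·-congʳ (fromℕ c) (𝕃.*-cong (×-congʳ d (𝕃.*-cong (mono²-^ 0 0 k) (mono²-^ 1 0 α))) (mono²-^ 0 1 β)) ⟩
    fromℕ c · ((d ×ᴸ (mono² 1# (k ℕ.* 0) (k ℕ.* 0) ⊗ mono² 1# (α ℕ.* 1) (α ℕ.* 0))) ⊗ yᵝ)
      ≈⟨ ·-congʳ (fromℕ c) (𝕃.*-congʳ {yᵝ} (×-mono d (1# * 1#) _ _)) ⟩
    fromℕ c · (mono (fromℕ d * (1# * 1#)) (ℤ.+ (2k0 ℕ.+ 2 ℕ.* (α ℕ.* 1))) (ℤ.+ (2k0 ℕ.+ 2 ℕ.* (α ℕ.* 0))) ⊗ yᵝ)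
      ≈⟨ mono-cong coefficient (≡.cong ℤ.+_ (exponent₀ β α k)) (≡.cong ℤ.+_ (exponent₁ β α k)) ⟩
    mono² (fromℕ (d ℕ.* c)) α β ∎
    where
    yᵝ = mono² 1# (β ℕ.* 0) (β ℕ.* 1)
    2k0 = 2 ℕ.* (k ℕ.* 0)
    exponent₀ : ∀ β α k → 2 ℕ.* (k ℕ.* 0) ℕ.+ 2 ℕ.* (α ℕ.* 1) ℕ.+ 2 ℕ.* (β ℕ.* 0) ≡ 2 ℕ.* α
    exponent₀ = solve-∀
    exponent₁ : ∀ β α k → 2 ℕ.* (k ℕ.* 0) ℕ.+ 2 ℕ.* (α ℕ.* 0) ℕ.+ 2 ℕ.* (β ℕ.* 1) ≡ 2 ℕ.* β
    exponent₁ = solve-∀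
    coefficient : fromℕ c * ((fromℕ d * (1# * 1#)) * 1#) ≈ fromℕ (d ℕ.* c)
    coefficient = trans (*-congˡ (trans (*-identityʳ _) (trans (*-congˡ (*-identityˡ 1#)) (*-identityʳ _))))
                        (trans (*-comm _ _) (sym (fromℕ-* d c)))

  trinomial-^ : ∀ m → trinomial ^ m ≈ᴸ geSum m
  trinomial-^ m = begin
    trinomial ^ m                                                   ≈⟨ Binomial.theorem m (one ⊕ x₀²) x₁² ⟩
    ∑< (suc m) (λ l → (m C l) ×ᴸ ((one ⊕ x₀²) ^ l ⊗ x₁² ^ (m ∸ l))) ≈⟨ ∑<-cong (suc m) (λ l _ → row l) ⟩
    geSum m                                                         ∎
    where
    row : ∀ l → (m C l) ×ᴸ ((one ⊕ x₀²) ^ l ⊗ x₁² ^ (m ∸ l)) ≈ᴸ ∑< (suc l) (geTerm m l)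
    row l = begin
      (m C l) ×ᴸ ((one ⊕ x₀²) ^ l ⊗ x₁² ^ (m ∸ l))
        ≈⟨ ×≈· (m C l) _ ⟩
      b · ((one ⊕ x₀²) ^ l ⊗ x₁² ^ (m ∸ l))
        ≈⟨ ·-congʳ b (𝕃.*-congʳ (Binomial.theorem l one x₀²)) ⟩
      b · (∑< (suc l) term ⊗ x₁² ^ (m ∸ l))
        ≈⟨ ·-congʳ b (*-distribʳ-∑< (x₁² ^ (m ∸ l)) (suc l) term) ⟩
      b · ∑< (suc l) termY
        ≈⟨ *-distribˡ-∑< (mono b (ℤ.+ 0) (ℤ.+ 0)) (suc l) termY ⟩
      ∑< (suc l) (λ k → b · termY k)
        ≈⟨ ∑<-cong (suc l) (λ k _ → trinomial-term (m C l) (l C k) k (l ∸ k) (m ∸ l)) ⟩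
      ∑< (suc l) (geTerm m l) ∎
      where
      b = fromℕ (m C l)
      term : ℕ → LP
      term k = (l C k) ×ᴸ (one ^ k ⊗ x₀² ^ (l ∸ k))
      termY : ℕ → LP
      termY k = term k ⊗ x₁² ^ (m ∸ l)

  xge-closedForm : ∀ m → xge m ≈ᴸ denom m ⊗ geSum m
  xge-closedForm m = begin
    xge m                          ≡⟨ ^ᴸ≡^ geBase m ⟩
    geBase ^ m                     ≈⟨ ^-congˡ m geBase≈denom⊗trinomial ⟩
    (denom 1 ⊗ trinomial) ^ m      ≈⟨ ^-distrib-* (denom 1) trinomial m ⟩
    denom 1 ^ m ⊗ trinomial ^ m    ≈⟨ 𝕃.*-cong (denom-^ m) (trinomial-^ m) ⟩
    denom m ⊗ geSum m              ∎

module LaurentListSums {c ℓ} (R : CommutativeRing c ℓ) where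
  open Laurent R
  open LaurentSemiring R
  open RangeSums (CommutativeSemiring.semiring laurentSemiring)

  ⨁-++ : ∀ ps qs → ⨁ (ps ++ qs) ≡ ⨁ ps ⊕ ⨁ qs
  ⨁-++ []       qs = ≡.refl
  ⨁-++ (p ∷ ps) qs = ≡.trans (≡.cong (p ++_) (⨁-++ ps qs)) (≡.sym (List.++-assoc p (⨁ ps) (⨁ qs)))

  ⨁-map-applyUpTo : ∀ (f : ℕ → LP) g n → ⨁ (map f (applyUpTo g n)) ≡ ∑< n (f ∘ g)
  ⨁-map-applyUpTo f g zero    = ≡.refl
  ⨁-map-applyUpTo f g (suc n) = ≡.cong (f (g 0) ++_) (⨁-map-applyUpTo f (g ∘ suc) n)

  ⨁-map-upTo : ∀ (f : ℕ → LP) n → ⨁ (map f (upTo n)) ≡ ∑< n f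
  ⨁-map-upTo f = ⨁-map-applyUpTo f (λ i → i)

  ⨁-concatMap-upTo : ∀ (f : ℕ → List LP) n → ⨁ (concatMap f (upTo n)) ≡ ∑< n (⨁ ∘ f)
  ⨁-concatMap-upTo f n = ≡.trans (⨁-concatMap (upTo n)) (⨁-map-upTo (⨁ ∘ f) n)
    where
    ⨁-concatMap : ∀ xs → ⨁ (concatMap f xs) ≡ ⨁ (map (⨁ ∘ f) xs)
    ⨁-concatMap []       = ≡.refl
    ⨁-concatMap (x ∷ xs) = ≡.trans (⨁-++ (f x) (concatMap f xs)) (≡.cong (⨁ (f x) ++_) (⨁-concatMap xs))

module Proposition {c ℓ} (R : CommutativeRing c ℓ) where
  open CommutativeRing R
  open RingOps R using (fromℕ; Unit)
  open Laurent R
  open LaurentSemiring R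
  open Monomials R
  open RangeSums 𝕃.semiring
  open GenericBasis R
  open LaurentListSums R
  open import Algebra.Properties.CommutativeSemigroup 𝕃.*-commutativeSemigroup using (x∙yz≈y∙xz)

  disjoint-sizes : ∀ {n} (I J : Subset n) → disjointᵇ I J ≡ true → ∣ I ∣ ℕ.+ ∣ J ∣ ≤ n
  disjoint-sizes []          []          _ = ℕ.z≤n
  disjoint-sizes (true ∷ I)  (false ∷ J) d = s≤s (disjoint-sizes I J d)
  disjoint-sizes (false ∷ I) (true ∷ J)  d rewrite ℕ.+-suc ∣ I ∣ ∣ J ∣ = s≤s (disjoint-sizes I J d)
  disjoint-sizes (false ∷ I) (false ∷ J) d = ℕ.m≤n⇒m≤1+n (disjoint-sizes I J d)

  S-vanishes : ∀ {n} (a : Vec Unit n) r → n < 2 ℕ.* r → S a r ≈ 0#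
  S-vanishes {n} a r n<2r = ΣK-map-filter-none _ _ (cartesianProduct (subsets n) (subsets n)) no-pair
    where
    ΣK-map-filter-none : ∀ {p} {P : A → Set p} (P? : Decidable P) (f : A → Carrier) xs →
                         (∀ x → ¬ P x) → ΣK (map f (filter P? xs)) ≈ 0#
    ΣK-map-filter-none P? f xs ¬P = reflexive (≡.cong (ΣK ∘ map f) (List.filter-none P? (All.universal ¬P xs)))
    no-pair : ∀ (IJ : Subset n × Subset n) →
              ¬ ((∣ proj₁ IJ ∣ ≡ r × ∣ proj₂ IJ ∣ ≡ r) × disjointᵇ (proj₁ IJ) (proj₂ IJ) ≡ true)
    no-pair (I , J) ((∣I∣≡r , ∣J∣≡r) , d) = ℕ.<⇒≱ n<2r (≡.subst (_≤ n) sizes (disjoint-sizes I J d))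
      where sizes = ≡.cong₂ ℕ._+_ ∣I∣≡r (≡.trans ∣J∣≡r (≡.sym (ℕ.+-identityʳ r)))

  module _ (n : ℕ) (a : Vec Unit n) where

    summandCoefficient : ℕ → ℕ → ℕ → ℕ
    summandCoefficient l k r = ((l ∸ r) C k) ℕ.* ((n ∸ 2 ℕ.* r) C (l ∸ r))

    summand : ℕ → ℕ → ℕ → LP
    summand l k r = mono² (fromℕ (summandCoefficient l k r) * S a r) (l ∸ k) (n ∸ l)

    xA-normal : xA n a ≈ᴸ denom n ⊗ ∑< (suc n) (λ l → ∑< (suc l) (λ k → ∑< (suc l) (summand l k)))
    xA-normal = ⊗-congʳ (denom n) (𝕃.trans (𝕃.reflexive (⨁-concatMap-upTo row (suc n))) (∑<-cong (suc n) λ l _ →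
      𝕃.trans (𝕃.reflexive (⨁-concatMap-upTo (entries l) (suc l))) (∑<-cong (suc l) λ k _ →
      𝕃.reflexive (⨁-map-upTo (summand l k) (suc l)))))
      where
      entries : ℕ → ℕ → List LP
      entries l k = map (summand l k) (upTo (suc l))
      row : ℕ → List LP
      row l = concatMap (entries l) (upTo (suc l))

    column : ℕ → LP
    column r = ∑< (suc n ∸ r) (λ l → ∑< (suc (r ℕ.+ l)) (λ k → summand (r ℕ.+ l) k r))

    column-vanishes : ∀ r → suc (n / 2) ≤ r → column r ≈ᴸ []
    column-vanishes r n/2<r = ∑<-zero (suc n ∸ r) λ l → ∑<-zero (suc (r ℕ.+ l)) λ k →
      mono-zero (ℤ.+ (2 ℕ.* (r ℕ.+ l ∸ k))) (ℤ.+ (2 ℕ.* (n ∸ (r ℕ.+ l))))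
        (trans (*-congˡ (S-vanishes a r (n/2<r⇒n<2r n/2<r))) (zeroʳ (fromℕ (summandCoefficient (r ℕ.+ l) k r))))

    module _ (r : ℕ) (2r≤n : 2 ℕ.* r ≤ n) where
      private
        m = n ∸ 2 ℕ.* r
        scale = S a r · mono² 1# r r

      shifted-coefficient : ∀ l k → summandCoefficient (r ℕ.+ l) k r ≡ (l C k) ℕ.* (m C l)
      shifted-coefficient l k = ≡.cong (λ l′ → (l′ C k) ℕ.* (m C l′)) (ℕ.m+n∸m≡n r l)

      summand-vanishes : ∀ l k → summandCoefficient (r ℕ.+ l) k r ≡ 0 → summand (r ℕ.+ l) k r ≈ᴸ []
      summand-vanishes l k c≡0 =
        mono-zero _ _ (trans (*-congʳ (reflexive (≡.cong fromℕ c≡0))) (zeroˡ (S a r)))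

      summand-shift : ∀ {l k} → k ≤ l → l ≤ m → summand (r ℕ.+ l) k r ≈ᴸ scale ⊗ geTerm m l k
      summand-shift {l} {k} k≤l l≤m =
        mono-cong coefficient (double r (l ∸ k) (ℕ.+-∸-assoc r k≤l)) (double r (m ∸ l) (∸-+-split n r 2r≤n l≤m))
        where
        double : ∀ {x} y z → x ≡ y ℕ.+ z → ℤ.+ (2 ℕ.* x) ≡ ℤ.+ (2 ℕ.* y ℕ.+ 2 ℕ.* z)
        double y z x≡y+z = ≡.cong ℤ.+_ (≡.trans (≡.cong (2 ℕ.*_) x≡y+z) (ℕ.*-distribˡ-+ 2 y z))
        coefficient : fromℕ (summandCoefficient (r ℕ.+ l) k r) * S a r ≈ (S a r * 1#) * fromℕ ((l C k) ℕ.* (m C l))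
        coefficient = trans (*-comm _ _)
          (*-cong (sym (*-identityʳ (S a r))) (reflexive (≡.cong fromℕ (shifted-coefficient l k))))

      column-truncate : column r ≈ᴸ ∑< (suc m) (λ l → ∑< (suc l) (λ k → summand (r ℕ.+ l) k r))
      column-truncate = 𝕃.trans
        (∑<-truncate _ m<n+1-r λ l m<l → ∑<-zero (suc (r ℕ.+ l)) λ k → summand-vanishes l k
          (≡.trans (shifted-coefficient l k) (≡.trans (≡.cong ((l C k) ℕ.*_) (k>n⇒nCk≡0 m<l)) (ℕ.*-zeroʳ (l C k)))))
        (∑<-cong (suc m) λ l _ → ∑<-truncate _ (s≤s (ℕ.m≤n+m l r)) λ k l<k → summand-vanishes l k
          (≡.trans (shifted-coefficient l k) (≡.cong (ℕ._* (m C l)) (k>n⇒nCk≡0 l<k))))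
        where
        r≤2r = ℕ.m≤m+n r (r ℕ.+ 0)
        m<n+1-r : suc m ≤ suc n ∸ r
        m<n+1-r = ℕ.≤-trans (s≤s (ℕ.∸-monoʳ-≤ n r≤2r))
                            (ℕ.≤-reflexive (≡.sym (ℕ.+-∸-assoc 1 (ℕ.≤-trans r≤2r 2r≤n))))

      column≈scale⊗geSum : column r ≈ᴸ scale ⊗ geSum m
      column≈scale⊗geSum = begin
        column r                                                                   ≈⟨ column-truncate ⟩
        ∑< (suc m) (λ l → ∑< (suc l) (λ k → summand (r ℕ.+ l) k r))
          ≈⟨ ∑<-cong (suc m) (λ l l<m+1 → ∑<-cong (suc l) λ k k<l+1 →
               summand-shift (ℕ.≤-pred k<l+1) (ℕ.≤-pred l<m+1)) ⟩
        ∑< (suc m) (λ l → ∑< (suc l) (λ k → scale ⊗ geTerm m l k))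
          ≈⟨ ∑<-cong (suc m) (λ l _ → *-distribˡ-∑< scale (suc l) (geTerm m l)) ⟨
        ∑< (suc m) (λ l → scale ⊗ ∑< (suc l) (geTerm m l))
          ≈⟨ *-distribˡ-∑< scale (suc m) (λ l → ∑< (suc l) (geTerm m l)) ⟨
        scale ⊗ geSum m                                                            ∎
        where open import Relation.Binary.Reasoning.Setoid 𝕃.setoid

      column-block : denom n ⊗ column r ≈ᴸ S a r · xge m
      column-block = begin
        denom n ⊗ column r                              ≈⟨ ⊗-congʳ (denom n) column≈scale⊗geSum ⟩
        denom n ⊗ ((S a r · mono² 1# r r) ⊗ geSum m)    ≈⟨ 𝕃.*-congˡ {denom n} (𝕃.*-assoc s e (geSum m)) ⟩
        denom n ⊗ (S a r · (mono² 1# r r ⊗ geSum m))    ≈⟨ x∙yz≈y∙xz (denom n) s (e ⊗ geSum m) ⟩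
        S a r · (denom n ⊗ (mono² 1# r r ⊗ geSum m))    ≈⟨ ·-congʳ (S a r) (𝕃.*-assoc (denom n) e (geSum m)) ⟨
        S a r · ((denom n ⊗ mono² 1# r r) ⊗ geSum m)    ≈⟨ ·-congʳ (S a r) (𝕃.*-congʳ {geSum m} (denom-⊗-mono² n r 2r≤n)) ⟩
        S a r · (denom m ⊗ geSum m)                     ≈⟨ ·-congʳ (S a r) (xge-closedForm m) ⟨
        S a r · xge m                                   ∎
        where
        open import Relation.Binary.Reasoning.Setoid 𝕃.setoid
        s = mono (S a r) (ℤ.+ 0) (ℤ.+ 0)
        e = mono² 1# r r

    expansion : xA n a ≈ᴸ ⨁ (map (λ r → S a r · xge (n ∸ 2 ℕ.* r)) (upTo (suc (n / 2))))
    expansion = begin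
      xA n a
        ≈⟨ xA-normal ⟩
      denom n ⊗ ∑< (suc n) (λ l → ∑< (suc l) (λ k → ∑< (suc l) (summand l k)))
        ≈⟨ ⊗-congʳ (denom n) (∑<-cong (suc n) λ l _ → ∑<-comm (suc l) (suc l) (summand l)) ⟩
      denom n ⊗ ∑< (suc n) (λ l → ∑< (suc l) (λ r → ∑< (suc l) (λ k → summand l k r)))
        ≈⟨ ⊗-congʳ (denom n) (∑<-triangle (suc n) (λ l r → ∑< (suc l) (λ k → summand l k r))) ⟩
      denom n ⊗ ∑< (suc n) column
        ≈⟨ ⊗-congʳ (denom n) (∑<-truncate column (s≤s (m/n≤m n 2)) column-vanishes) ⟩
      denom n ⊗ ∑< (suc (n / 2)) column
        ≈⟨ *-distribˡ-∑< (denom n) (suc (n / 2)) column ⟩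
      ∑< (suc (n / 2)) (λ r → denom n ⊗ column r)
        ≈⟨ ∑<-cong (suc (n / 2)) (λ r r<n/2+1 → column-block r (r≤n/2⇒2r≤n (ℕ.≤-pred r<n/2+1))) ⟩
      ∑< (suc (n / 2)) (λ r → S a r · xge (n ∸ 2 ℕ.* r))
        ≡⟨ ⨁-map-upTo (λ r → S a r · xge (n ∸ 2 ℕ.* r)) (suc (n / 2)) ⟨
      ⨁ (map (λ r → S a r · xge (n ∸ 2 ℕ.* r)) (upTo (suc (n / 2)))) ∎
      where open import Relation.Binary.Reasoning.Setoid 𝕃.setoid

open import Data.Nat using (_*_)

proposition7p2 : ∀ {c ℓ} (K : Field c ℓ) → IsAlgClosed K → CharZero K →
    ∀ (n : ℕ) (a : Vec (RingOps.Unit (Field.commutativeRing K)) n) →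
      let open Laurent (Field.commutativeRing K) in
      xA n a ≋ ⨁ (map (λ r → S a r · xge (n ∸ 2 * r)) (upTo (suc (n / 2))))
proposition7p2 K _ _ n a = LaurentSemiring.unwrap (Proposition.expansion (Field.commutativeRing K) n a)
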